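{- Let $N\ge 1$ be an integer and write $N=n^2+m$ with integers $n\ge 0$ and $1\le m\le 2n+1$ (this representation is unique). Let $F_B(N)=\max S(G)$, the maximum taken over all bipartite graphs $G$ with exactly $N$ edges. Then: (1) If $1\le m\le n$, then $F_B(N)=n^3+m^2$, and this is attained by the graph obtained from $K_{n,n}$ by adding one new vertex adjacent to exactly $m$ vertices of one side of the bipartition of $K_{n,n}$. (2) If $n+1\le m\le 2n+1$, then $F_B(N)=n^3+n^2+m(m-n)$, and this is attained by the graph obtained from $K_{n+1,n+1}$ by removing $2n+1-m$ pairwise disjoint edges.
   Context: All graphs are finite and simple. For a graph $G$ with edge set $E(G)$, the specialty of $G$ is $S(G)=\sum_{uv\in E(G)}\min(\deg u,\deg v)$. -}

module Defs where

open import Data.Nat using (ℕ; zero; suc; _+_; _*_; _⊓_; _≤_; _∸_; _≡ᵇ_; _<ᵇ_; _≤ᵇ_)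
open import Data.Nat.Properties using (≡ᵇ⇒≡; ≡⇒≡ᵇ)
open import Data.Bool using (Bool; true; false; _∧_; _∨_; not; if_then_else_)
open import Data.Bool.Properties using (∨-comm; ∧-zeroʳ)
open import Data.Fin using (Fin; toℕ; zero; suc)
open import Data.Product using (Σ; _×_)
open import Relation.Binary.PropositionalEquality using (_≡_; _≢_; refl; cong₂; sym)

record Graph (v : ℕ) : Set where
  field
    adj    : Fin v → Fin v → Bool
    adj-sym    : ∀ i j → adj i j ≡ adj j i
    adj-irrefl : ∀ i → adj i i ≡ false
open Graph public

sumFin : {v : ℕ} → (Fin v → ℕ) → ℕ
sumFin {zero}  f = 0
sumFin {suc v} f = f zero + sumFin (λ i → f (suc i))

deg : {v : ℕ} → Graph v → Fin v → ℕ
deg G i = sumFin (λ j → if adj G i j then 1 else 0)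

edgeSum : {v : ℕ} → Graph v → (Fin v → Fin v → ℕ) → ℕ
edgeSum G f = sumFin (λ i → sumFin (λ j →
  if adj G i j ∧ (toℕ i <ᵇ toℕ j) then f i j else 0))

numEdges : {v : ℕ} → Graph v → ℕ
numEdges G = edgeSum G (λ _ _ → 1)

specialty : {v : ℕ} → Graph v → ℕ
specialty G = edgeSum G (λ i j → deg G i ⊓ deg G j)

Bipartite : {v : ℕ} → Graph v → Set
Bipartite {v} G = Σ (Fin v → Bool) (λ c → ∀ i j → adj G i j ≡ true → c i ≢ c j)

BipUpperBound : ℕ → ℕ → Set
BipUpperBound N val = ∀ (v : ℕ) (G : Graph v) → Bipartite G → numEdges G ≡ N → specialty G ≤ val

Attains : {v : ℕ} → Graph v → ℕ → ℕ → Set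
Attains G N val = Bipartite G × numEdges G ≡ N × specialty G ≡ val

private
  ≡ᵇ-refl : ∀ a → (a ≡ᵇ a) ≡ true
  ≡ᵇ-refl zero = refl
  ≡ᵇ-refl (suc a) = ≡ᵇ-refl a

fromRel : (v : ℕ) → (ℕ → ℕ → Bool) → Graph v
fromRel v r = record
  { adj = λ i j → (r (toℕ i) (toℕ j) ∨ r (toℕ j) (toℕ i)) ∧ not (toℕ i ≡ᵇ toℕ j)
  ; adj-sym = λ i j → cong₂ _∧_ (∨-comm (r (toℕ i) (toℕ j)) (r (toℕ j) (toℕ i)))
                                (cong-not (≡ᵇ-sym (toℕ i) (toℕ j)))
  ; adj-irrefl = λ i → irr (r (toℕ i) (toℕ i) ∨ r (toℕ i) (toℕ i)) (toℕ i)
  }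
  where
  cong-not : ∀ {a b} → a ≡ b → not a ≡ not b
  cong-not refl = refl
  ≡ᵇ-sym : ∀ a b → (a ≡ᵇ b) ≡ (b ≡ᵇ a)
  ≡ᵇ-sym zero zero = refl
  ≡ᵇ-sym zero (suc b) = refl
  ≡ᵇ-sym (suc a) zero = refl
  ≡ᵇ-sym (suc a) (suc b) = ≡ᵇ-sym a b
  irr : ∀ x a → x ∧ not (a ≡ᵇ a) ≡ false
  irr x a rewrite ≡ᵇ-refl a = ∧-zeroʳ x

-- Case (1) extremal graph: K_{n,n} on vertices 0..n-1 (side A) and
-- n..2n-1 (side B), plus vertex 2n adjacent to the m vertices 0..m-1 of side A.
extremal₁ : (n m : ℕ) → Graph (suc (n + n))
extremal₁ n m = fromRel (suc (n + n)) (λ a b →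
  ((a <ᵇ n) ∧ ((n ≤ᵇ b) ∧ (b <ᵇ n + n))) ∨ ((a ≡ᵇ n + n) ∧ (b <ᵇ m)))

-- Case (2) extremal graph: K_{n+1,n+1} on vertices 0..n (side A) and
-- n+1..2n+1 (side B), with the k = 2n+1-m pairwise disjoint edges
-- {i, n+1+i} (i < k) removed.
extremal₂ : (n m : ℕ) → Graph (suc n + suc n)
extremal₂ n m = fromRel (suc n + suc n) (λ a b →
  (a <ᵇ suc n) ∧ ((suc n ≤ᵇ b) ∧ not ((b ≡ᵇ a + suc n) ∧ (a <ᵇ (2 * n + 1) ∸ m))))

-- Let c be a proper 2-colouring of a bipartite graph with N edges. Every edge has exactly one endpoint
-- of colour true, so S(G) is the sum over those vertices a of Σ_{b ∼ a} min(d_a, d_b), and this inner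
-- sum is at most d_a² and at most Σ_{b ∉ class} d_b = N; moreover Σ_a d_a = N. Maximising Σ min(d_a², N)
-- under this constraint is a packing problem: degrees > n contribute at most N each, and by convexity
-- of squares the others can be merged into bins of size at most n. What remains is K N + q n² + r² with
-- K (n + 1) + q n + r ≤ N and r ≤ n, which a case distinction of K + q against n bounds by the claimed
-- values. The extremal graphs have no edges inside the index blocks [0, p) and [p, p + q), so their
-- degrees, edge numbers and specialties reduce to explicit sums over the p × q grid.

module Submission where

open import Defs
open import Data.Nat
open import Data.Nat.Properties
open import Data.Nat.Tactic.RingSolver using (solve)
open import Algebra.Properties.CommutativeSemigroup +-commutativeSemigroup
  using () renaming (interchange to +-interchange)
open import Data.Bool using (Bool; true; false; _∧_; _∨_; not; if_then_else_; T)
open import Data.Bool.Properties using (∨-comm; ∧-zeroʳ; ∧-identityʳ; ∨-identityʳ)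
open import Data.Fin using (Fin; toℕ; zero; suc)
open import Data.Fin.Properties using (toℕ-injective; toℕ<n)
open import Data.List.Base using (_∷_; [])
open import Data.Product using (Σ; _×_; _,_)
open import Data.Empty using (⊥-elim)
open import Data.Sum using (_⊎_; inj₁; inj₂)
open import Function using (_∘_)
open import Relation.Binary.PropositionalEquality
open import Relation.Binary.Definitions using (tri<; tri≈; tri>)
open import Relation.Nullary using (yes; no)

ind : Bool → ℕ
ind b = if b then 1 else 0

if-distinct-+ : ∀ {x y : Bool} (a b : ℕ) → x ≢ y →
  (if x then a else 0) + (if y then b else 0) ≡ (if x then a else b)
if-distinct-+ {false} {false} a b x≢y = ⊥-elim (x≢y refl)
if-distinct-+ {false} {true}  a b _   = refl
if-distinct-+ {true}  {false} a b _   = +-identityʳ a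
if-distinct-+ {true}  {true}  a b x≢y = ⊥-elim (x≢y refl)

<ᵇ-true : ∀ {a b} → a < b → (a <ᵇ b) ≡ true
<ᵇ-true (s≤s z≤n)       = refl
<ᵇ-true (s≤s (s≤s a<b)) = <ᵇ-true (s≤s a<b)

<ᵇ-false : ∀ {a b} → b ≤ a → (a <ᵇ b) ≡ false
<ᵇ-false z≤n       = refl
<ᵇ-false (s≤s b≤a) = <ᵇ-false b≤a

≤ᵇ-true : ∀ {a b} → a ≤ b → (a ≤ᵇ b) ≡ true
≤ᵇ-true z≤n       = refl
≤ᵇ-true (s≤s a≤b) = <ᵇ-true (s≤s a≤b)

≤ᵇ-false : ∀ {a b} → b < a → (a ≤ᵇ b) ≡ false
≤ᵇ-false (s≤s b<a) = <ᵇ-false b<a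

≡ᵇ-refl : ∀ a → (a ≡ᵇ a) ≡ true
≡ᵇ-refl zero    = refl
≡ᵇ-refl (suc a) = ≡ᵇ-refl a

≡ᵇ-false : ∀ {a b} → a ≢ b → (a ≡ᵇ b) ≡ false
≡ᵇ-false {zero}  {zero}  a≢b = ⊥-elim (a≢b refl)
≡ᵇ-false {zero}  {suc b} _   = refl
≡ᵇ-false {suc a} {zero}  _   = refl
≡ᵇ-false {suc a} {suc b} a≢b = ≡ᵇ-false (a≢b ∘ cong suc)

≡ᵇ-sym : ∀ a b → (a ≡ᵇ b) ≡ (b ≡ᵇ a)
≡ᵇ-sym zero    zero    = refl
≡ᵇ-sym zero    (suc b) = refl
≡ᵇ-sym (suc a) zero    = refl
≡ᵇ-sym (suc a) (suc b) = ≡ᵇ-sym a b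

<ᵇ-asym : ∀ a b → a ≢ b → (a <ᵇ b) ≢ (b <ᵇ a)
<ᵇ-asym zero    zero    a≢b = ⊥-elim (a≢b refl)
<ᵇ-asym zero    (suc b) _   = λ ()
<ᵇ-asym (suc a) zero    _   = λ ()
<ᵇ-asym (suc a) (suc b) a≢b = <ᵇ-asym a b (a≢b ∘ cong suc)

sumFin-cong : ∀ {v} {f g : Fin v → ℕ} → (∀ i → f i ≡ g i) → sumFin f ≡ sumFin g
sumFin-cong {zero}  _   = refl
sumFin-cong {suc v} f≡g = cong₂ _+_ (f≡g zero) (sumFin-cong (f≡g ∘ suc))

sumFin-mono : ∀ {v} {f g : Fin v → ℕ} → (∀ i → f i ≤ g i) → sumFin f ≤ sumFin g
sumFin-mono {zero}  _   = z≤n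
sumFin-mono {suc v} f≤g = +-mono-≤ (f≤g zero) (sumFin-mono (f≤g ∘ suc))

sumFin-zero : ∀ {v} → sumFin {v} (λ _ → 0) ≡ 0
sumFin-zero {zero}  = refl
sumFin-zero {suc v} = sumFin-zero {v}

sumFin-+ : ∀ {v} (f g : Fin v → ℕ) → sumFin (λ i → f i + g i) ≡ sumFin f + sumFin g
sumFin-+ {zero}  f g = refl
sumFin-+ {suc v} f g = trans (cong ((f zero + g zero) +_) (sumFin-+ (f ∘ suc) (g ∘ suc)))
                             (+-interchange (f zero) (g zero) (sumFin (f ∘ suc)) (sumFin (g ∘ suc)))

sumFin-*ˡ : ∀ {v} c (f : Fin v → ℕ) → sumFin (λ i → c * f i) ≡ c * sumFin f
sumFin-*ˡ {zero}  c f = sym (*-zeroʳ c)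
sumFin-*ˡ {suc v} c f = trans (cong (c * f zero +_) (sumFin-*ˡ c (f ∘ suc)))
                              (sym (*-distribˡ-+ c (f zero) _))

sumFin² : ∀ {v w} → (Fin v → Fin w → ℕ) → ℕ
sumFin² F = sumFin (λ i → sumFin (F i))

sumFin²-transpose : ∀ {v w} (F : Fin v → Fin w → ℕ) →
  sumFin² F ≡ sumFin² (λ j i → F i j)
sumFin²-transpose {zero}  {w} F = sym (sumFin-zero {w})
sumFin²-transpose {suc v} {w} F = begin
    sumFin (F zero) + sumFin² (F ∘ suc)
  ≡⟨ cong (sumFin (F zero) +_) (sumFin²-transpose (F ∘ suc)) ⟩
    sumFin (F zero) + sumFin² (λ j i → F (suc i) j)
  ≡⟨ sym (sumFin-+ (F zero) (λ j → sumFin (λ i → F (suc i) j))) ⟩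
    sumFin² (λ j i → F i j) ∎
  where open ≡-Reasoning

sumFin²-symmetrise : ∀ {v} (F : Fin v → Fin v → ℕ) →
  sumFin² F + sumFin² F ≡ sumFin² (λ i j → F i j + F j i)
sumFin²-symmetrise F = begin
    sumFin² F + sumFin² F
  ≡⟨ cong (sumFin² F +_) (sumFin²-transpose F) ⟩
    sumFin² F + sumFin² (λ i j → F j i)
  ≡⟨ sym (sumFin-+ (λ i → sumFin (F i)) (λ i → sumFin (λ j → F j i))) ⟩
    sumFin (λ i → sumFin (F i) + sumFin (λ j → F j i))
  ≡⟨ sumFin-cong (λ i → sym (sumFin-+ (F i) (λ j → F j i))) ⟩
    sumFin² (λ i j → F i j + F j i) ∎
  where open ≡-Reasoning

sumFin²-cong-symmetrised : ∀ {v} (F G : Fin v → Fin v → ℕ) →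
  (∀ i j → F i j + F j i ≡ G i j + G j i) → sumFin² F ≡ sumFin² G
sumFin²-cong-symmetrised F G eq = +-cancel-double (begin
    sumFin² F + sumFin² F
  ≡⟨ sumFin²-symmetrise F ⟩
    sumFin² (λ i j → F i j + F j i)
  ≡⟨ sumFin-cong (λ i → sumFin-cong (eq i)) ⟩
    sumFin² (λ i j → G i j + G j i)
  ≡⟨ sym (sumFin²-symmetrise G) ⟩
    sumFin² G + sumFin² G ∎)
  where
  open ≡-Reasoning
  +-cancel-double : ∀ {a b} → a + a ≡ b + b → a ≡ b
  +-cancel-double {a} {b} a+a≡b+b with <-cmp a b
  ... | tri< a<b _ _ = ⊥-elim (<⇒≢ (+-mono-< a<b a<b) a+a≡b+b)
  ... | tri≈ _ a≡b _ = a≡b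
  ... | tri> _ _ b<a = ⊥-elim (<⇒≢ (+-mono-< b<a b<a) (sym a+a≡b+b))

sumFin-if : ∀ {v} (b : Bool) (g : Fin v → ℕ) →
  sumFin (λ j → if b then g j else 0) ≡ (if b then sumFin g else 0)
sumFin-if true  g = refl
sumFin-if {v} false g = sumFin-zero {v}

ProperColouring : ∀ {v} → Graph v → (Fin v → Bool) → Set
ProperColouring G c = ∀ i j → adj G i j ≡ true → c i ≢ c j

classDeg : ∀ {v} → Graph v → (Fin v → Bool) → Fin v → ℕ
classDeg G c i = if c i then deg G i else 0

module _ {v} (G : Graph v) where

  private
    adj-true-sym : ∀ {i j} → adj G i j ≡ true → adj G j i ≡ true
    adj-true-sym {i} {j} = trans (adj-sym G j i)

    adj⇒toℕ-≢ : ∀ {i j} → adj G i j ≡ true → toℕ i ≢ toℕ j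
    adj⇒toℕ-≢ {i} a i≡j with toℕ-injective i≡j
    ... | refl with () ← trans (sym a) (adj-irrefl G i)

    if-zero : ∀ (x : Bool) → (if x then 0 else 0) ≡ 0
    if-zero true  = refl
    if-zero false = refl

    if-symmetric : ∀ (x : Bool) {a b : ℕ} → b ≡ a → (if x then a else b) ≡ a
    if-symmetric true  _    = refl
    if-symmetric false b≡a = b≡a

  edgeSum-byColourClass : ∀ c → ProperColouring G c →
    (f : Fin v → Fin v → ℕ) → (∀ i j → f i j ≡ f j i) →
    edgeSum G f ≡ sumFin (λ i → if c i then sumFin (λ j → if adj G i j then f i j else 0) else 0)
  edgeSum-byColourClass c proper f f-sym = trans
    (sumFin²-cong-symmetrised _ (λ i j → if c i then (if adj G i j then f i j else 0) else 0) pairs)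
    (sumFin-cong (λ i → sumFin-if {v} (c i) (λ j → if adj G i j then f i j else 0)))
    where
    pairs : ∀ i j →
      (if adj G i j ∧ (toℕ i <ᵇ toℕ j) then f i j else 0)
        + (if adj G j i ∧ (toℕ j <ᵇ toℕ i) then f j i else 0)
      ≡ (if c i then (if adj G i j then f i j else 0) else 0) + (if c j then (if adj G j i then f j i else 0) else 0)
    pairs i j with adj G i j in a | adj G j i in a'
    ... | false | false = sym (cong₂ _+_ (if-zero (c i)) (if-zero (c j)))
    ... | false | true  with () ← trans (sym a) (adj-true-sym a')
    ... | true  | false with () ← trans (sym a') (adj-true-sym a)
    ... | true  | true  = begin
        (if toℕ i <ᵇ toℕ j then f i j else 0) + (if toℕ j <ᵇ toℕ i then f j i else 0)
      ≡⟨ if-distinct-+ (f i j) (f j i) (<ᵇ-asym (toℕ i) (toℕ j) (adj⇒toℕ-≢ a)) ⟩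
        (if toℕ i <ᵇ toℕ j then f i j else f j i)
      ≡⟨ if-symmetric (toℕ i <ᵇ toℕ j) (f-sym j i) ⟩
        f i j
      ≡⟨ sym (if-symmetric (c i) (f-sym j i)) ⟩
        (if c i then f i j else f j i)
      ≡⟨ sym (if-distinct-+ (f i j) (f j i) (proper i j a)) ⟩
        (if c i then f i j else 0) + (if c j then f j i else 0) ∎
      where open ≡-Reasoning

  numEdges-byColourClass : ∀ c → ProperColouring G c → numEdges G ≡ sumFin (classDeg G c)
  numEdges-byColourClass c proper = edgeSum-byColourClass c proper (λ _ _ → 1) (λ _ _ → refl)

  specialty≤sumFin-min-classDeg² : ∀ c → ProperColouring G c →
    specialty G ≤ sumFin (λ i → classDeg G c i * classDeg G c i ⊓ numEdges G)
  specialty≤sumFin-min-classDeg² c proper = begin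
      specialty G
    ≡⟨ edgeSum-byColourClass c proper _ (λ i j → ⊓-comm (deg G i) (deg G j)) ⟩
      sumFin (λ i → if c i then row i else 0)
    ≤⟨ sumFin-mono row≤ ⟩
      sumFin (λ i → classDeg G c i * classDeg G c i ⊓ numEdges G) ∎
    where
    open ≤-Reasoning
    row : Fin v → ℕ
    row i = sumFin (λ j → if adj G i j then deg G i ⊓ deg G j else 0)

    proper-not : ProperColouring G (not ∘ c)
    proper-not i j a = proper i j a ∘ not-injective
      where
      not-injective : ∀ {x y} → not x ≡ not y → x ≡ y
      not-injective {false} {false} _ = refl
      not-injective {true}  {true}  _ = refl

    row≤deg² : ∀ i → row i ≤ deg G i * deg G i
    row≤deg² i = begin
        row i
      ≤⟨ sumFin-mono (λ j → edge≤ (adj G i j)) ⟩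
        sumFin (λ j → deg G i * ind (adj G i j))
      ≡⟨ sumFin-*ˡ (deg G i) (λ j → ind (adj G i j)) ⟩
        deg G i * deg G i ∎
      where
      edge≤ : ∀ {j} b → (if b then deg G i ⊓ deg G j else 0) ≤ deg G i * ind b
      edge≤ true  = ≤-trans (m⊓n≤m _ _) (≤-reflexive (sym (*-identityʳ _)))
      edge≤ false = z≤n

    row≤numEdges : ∀ i → c i ≡ true → row i ≤ numEdges G
    row≤numEdges i ci = begin
        row i
      ≤⟨ sumFin-mono edge≤ ⟩
        sumFin (classDeg G (not ∘ c))
      ≡⟨ sym (numEdges-byColourClass (not ∘ c) proper-not) ⟩
        numEdges G ∎
      where
      edge≤ : ∀ j → (if adj G i j then deg G i ⊓ deg G j else 0) ≤ classDeg G (not ∘ c) j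
      edge≤ j with adj G i j in a | c j in cj
      ... | false | _     = z≤n
      ... | true  | false = m⊓n≤n _ _
      ... | true  | true  = ⊥-elim (proper i j a (trans ci (sym cj)))

    row≤ : ∀ i → (if c i then row i else 0) ≤ classDeg G c i * classDeg G c i ⊓ numEdges G
    row≤ i with c i in ci
    ... | true  = ⊓-glb (row≤deg² i) (row≤numEdges i ci)
    ... | false = z≤n

-- With n = s + b + a, r = s + b and d = a + s the two sides differ by 2ab.
sq-overflow : ∀ {n r d} → r ≤ n → d ≤ n → n ≤ r + d →
  Σ ℕ λ s → s ≤ n × n + s ≡ r + d × r * r + d * d ≤ n * n + s * s
sq-overflow {r = r} r≤n d≤n n≤r+d with m≤n⇒∃[o]m+o≡n r≤n
... | a , refl with m≤n⇒∃[o]m+o≡n (+-cancelˡ-≤ r a _ n≤r+d)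
... | s , refl with m≤n⇒∃[o]m+o≡n (+-cancelʳ-≤ a s r (subst (_≤ r + a) (+-comm a s) d≤n))
... | b , refl =
  s , ≤-trans (m≤m+n s (b + a)) (≤-reflexive (solve (s ∷ a ∷ b ∷ [])))
    , solve (s ∷ a ∷ b ∷ [])
    , ≤-trans (m≤m+n _ (2 * (a * b))) (≤-reflexive (solve (s ∷ a ∷ b ∷ [])))

sq-superadditive : ∀ r d → r * r + d * d ≤ (r + d) * (r + d)
sq-superadditive r d = ≤-trans (m≤m+n _ (2 * (r * d))) (≤-reflexive (solve (r ∷ d ∷ [])))

-- Items of size d and worth min(d², N) are split into `large` ones of size > n, worth at most N each,
-- and bins of capacity n, all full but one holding `rest`; by convexity a bin is worth at most its
-- size squared.
record Packing (n N total value : ℕ) : Set where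
  constructor packed
  field
    large full rest : ℕ
    rest≤n : rest ≤ n
    size≤  : large * suc n + full * n + rest ≤ total
    value≤ : value ≤ large * N + full * (n * n) + rest * rest

packing-empty : ∀ {n N} → Packing n N 0 0
packing-empty = packed 0 0 0 z≤n z≤n z≤n

packing-large : ∀ {n N S V d} → suc n ≤ d → Packing n N S V → Packing n N (d + S) (d * d ⊓ N + V)
packing-large {n} {N} {d = d} n<d (packed K q r r≤n size≤ value≤) = packed (suc K) q r r≤n
  (begin
    suc K * suc n + q * n + r
  ≡⟨ solve (n ∷ K ∷ q ∷ r ∷ []) ⟩
    suc n + (K * suc n + q * n + r)
  ≤⟨ +-mono-≤ n<d size≤ ⟩
    d + _ ∎)
  (begin
    d * d ⊓ N + _
  ≤⟨ +-mono-≤ (m⊓n≤n (d * d) N) value≤ ⟩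
    N + (K * N + q * (n * n) + r * r)
  ≡⟨ solve (N ∷ n ∷ K ∷ q ∷ r ∷ []) ⟩
    suc K * N + q * (n * n) + r * r ∎)
  where open ≤-Reasoning

packing-small : ∀ {n N S V d} → d ≤ n → Packing n N S V → Packing n N (d + S) (d * d ⊓ N + V)
packing-small {n} {N} {d = d} d≤n (packed K q r r≤n size≤ value≤) with r + d ≤? n
... | yes fits = packed K q (r + d) fits
  (begin
    K * suc n + q * n + (r + d)
  ≡⟨ solve (n ∷ K ∷ q ∷ r ∷ d ∷ []) ⟩
    d + (K * suc n + q * n + r)
  ≤⟨ +-monoʳ-≤ d size≤ ⟩
    d + _ ∎)
  (begin
    d * d ⊓ N + _
  ≤⟨ +-mono-≤ (m⊓n≤m (d * d) N) value≤ ⟩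
    d * d + (K * N + q * (n * n) + r * r)
  ≡⟨ solve (N ∷ n ∷ K ∷ q ∷ r ∷ d ∷ []) ⟩
    K * N + q * (n * n) + (r * r + d * d)
  ≤⟨ +-monoʳ-≤ (K * N + q * (n * n)) (sq-superadditive r d) ⟩
    K * N + q * (n * n) + (r + d) * (r + d) ∎)
  where open ≤-Reasoning
... | no overflows with sq-overflow r≤n d≤n (<⇒≤ (≰⇒> overflows))
... | s , s≤n , n+s≡r+d , exchange = packed K (suc q) s s≤n
  (begin
    K * suc n + suc q * n + s
  ≡⟨ solve (n ∷ K ∷ q ∷ s ∷ []) ⟩
    K * suc n + q * n + (n + s)
  ≡⟨ cong (K * suc n + q * n +_) n+s≡r+d ⟩
    K * suc n + q * n + (r + d)
  ≡⟨ solve (n ∷ K ∷ q ∷ r ∷ d ∷ []) ⟩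
    d + (K * suc n + q * n + r)
  ≤⟨ +-monoʳ-≤ d size≤ ⟩
    d + _ ∎)
  (begin
    d * d ⊓ N + _
  ≤⟨ +-mono-≤ (m⊓n≤m (d * d) N) value≤ ⟩
    d * d + (K * N + q * (n * n) + r * r)
  ≡⟨ solve (N ∷ n ∷ K ∷ q ∷ r ∷ d ∷ []) ⟩
    K * N + q * (n * n) + (r * r + d * d)
  ≤⟨ +-monoʳ-≤ (K * N + q * (n * n)) exchange ⟩
    K * N + q * (n * n) + (n * n + s * s)
  ≡⟨ solve (N ∷ n ∷ K ∷ q ∷ s ∷ []) ⟩
    K * N + suc q * (n * n) + s * s ∎)
  where open ≤-Reasoning

packing : ∀ {v} n N (e : Fin v → ℕ) → Packing n N (sumFin e) (sumFin (λ i → e i * e i ⊓ N))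
packing {zero}  n N e = packing-empty
packing {suc v} n N e with suc n ≤? e zero
... | yes large = packing-large large (packing n N (e ∘ suc))
... | no  small = packing-small (≤-pred (≰⇒> small)) (packing n N (e ∘ suc))

PackingBound : ℕ → ℕ → ℕ → Set
PackingBound n N val =
  ∀ K q r → r ≤ n → K * suc n + q * n + r ≤ N → K * N + q * (n * n) + r * r ≤ val

bipUpperBound-fromPacking : ∀ n N val → PackingBound n N val → BipUpperBound N val
bipUpperBound-fromPacking n N val bound v G (c , proper) refl = begin
    specialty G
  ≤⟨ specialty≤sumFin-min-classDeg² G c proper ⟩
    sumFin (λ i → classDeg G c i * classDeg G c i ⊓ numEdges G)
  ≤⟨ value≤ ⟩
    large * numEdges G + full * (n * n) + rest * rest
  ≤⟨ bound large full rest rest≤n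
      (≤-trans size≤ (≤-reflexive (sym (numEdges-byColourClass G c proper)))) ⟩
    val ∎
  where
  open ≤-Reasoning
  open Packing (packing n (numEdges G) (classDeg G c))

-- P counts the large items together with the full bins.
BinBound : ℕ → ℕ → ℕ → Set
BinBound n m val =
  ∀ P K r → K ≤ P → r ≤ n → P * n + K + r ≤ n * n + m → P * (n * n) + K * m + r * r ≤ val

packingBound-fromBins : ∀ n m val → BinBound n m val → PackingBound n (n * n + m) val
packingBound-fromBins n m val bound K q r r≤n size≤ = begin
    K * (n * n + m) + q * (n * n) + r * r
  ≡⟨ solve (n ∷ m ∷ K ∷ q ∷ r ∷ []) ⟩
    (K + q) * (n * n) + K * m + r * r
  ≤⟨ bound (K + q) K r (m≤m+n K q) r≤n (≤-trans (≤-reflexive size≡) size≤) ⟩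
    val ∎
  where
  open ≤-Reasoning
  size≡ : (K + q) * n + K + r ≡ K * suc n + q * n + r
  size≡ = solve (n ∷ K ∷ q ∷ r ∷ [])

sq≤-split : ∀ m c r → r ≤ m + c → r * r ≤ m * r + (m + c) * c
sq≤-split m c r r≤m+c with r ≤? m
... | yes r≤m = ≤-trans (*-monoˡ-≤ r r≤m) (m≤m+n (m * r) _)
... | no  r≰m with m≤n⇒∃[o]m+o≡n (<⇒≤ (≰⇒> r≰m))
...   | s , refl = begin
    (m + s) * (m + s)
  ≡⟨ solve (m ∷ s ∷ []) ⟩
    m * (m + s) + s * (m + s)
  ≤⟨ +-monoʳ-≤ (m * (m + s)) (*-mono-≤ (+-cancelˡ-≤ m s c r≤m+c) r≤m+c) ⟩
    m * (m + s) + c * (m + c)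
  ≡⟨ cong (m * (m + s) +_) (*-comm c (m + c)) ⟩
    m * (m + s) + (m + c) * c ∎
  where open ≤-Reasoning

manyBins₁ : ∀ n m p K r → p * n + K + r ≤ m →
  (n + p) * (n * n) + K * m + r * r ≤ n ^ 3 + m ^ 2
manyBins₁ n m p K r size≤ = begin
    (n + p) * (n * n) + K * m + r * r
  ≡⟨ solve (n ∷ m ∷ p ∷ K ∷ r ∷ []) ⟩
    n * (n * (n * 1)) + (p * n * n + K * m + r * r)
  ≤⟨ +-monoʳ-≤ (n * (n * (n * 1)))
      (+-mono-≤ (+-monoˡ-≤ (K * m) (pn*n≤pn*m p pn≤m)) (*-monoʳ-≤ r r≤m)) ⟩
    n * (n * (n * 1)) + (p * n * m + K * m + r * m)
  ≡⟨ solve (n ∷ m ∷ p ∷ K ∷ r ∷ []) ⟩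
    n * (n * (n * 1)) + m * (p * n + K + r)
  ≤⟨ +-monoʳ-≤ (n * (n * (n * 1))) (*-monoʳ-≤ m size≤) ⟩
    n * (n * (n * 1)) + m * m
  ≡⟨ cong (n * (n * (n * 1)) +_) (cong (m *_) (sym (*-identityʳ m))) ⟩
    n ^ 3 + m ^ 2 ∎
  where
  open ≤-Reasoning
  r≤m : r ≤ m
  r≤m = ≤-trans (m≤n+m r (p * n + K)) size≤
  pn≤m : p * n ≤ m
  pn≤m = ≤-trans (m≤m+n (p * n) K) (≤-trans (m≤m+n (p * n + K) r) size≤)
  pn*n≤pn*m : ∀ p → p * n ≤ m → p * n * n ≤ p * n * m
  pn*n≤pn*m zero    _    = z≤n
  pn*n≤pn*m (suc p) pn≤m = *-monoʳ-≤ (suc p * n) (≤-trans (m≤m+n n (p * n)) pn≤m)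

-- Here n = m + c; with r² ≤ m r + n c the claim reduces to (P + 1) n c ≤ n² c.
fewBins₁ : ∀ m c P K r → suc P ≤ m + c → r ≤ m + c → P * (m + c) + K + r ≤ (m + c) * (m + c) + m →
  P * ((m + c) * (m + c)) + K * m + r * r ≤ (m + c) ^ 3 + m ^ 2
fewBins₁ m c P K r P<n r≤n size≤ = let n = m + c in +-cancelʳ-≤ (m * (P * n + r)) _ _ (begin
    P * (n * n) + K * m + r * r + m * (P * n + r)
  ≡⟨ solve (m ∷ c ∷ P ∷ K ∷ r ∷ []) ⟩
    P * (n * n) + m * (P * n + K + r) + r * r
  ≤⟨ +-monoˡ-≤ (r * r) (+-monoʳ-≤ (P * (n * n)) (*-monoʳ-≤ m size≤)) ⟩
    P * (n * n) + m * (n * n + m) + r * r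
  ≤⟨ +-monoʳ-≤ (P * (n * n) + m * (n * n + m)) (sq≤-split m c r r≤n) ⟩
    P * (n * n) + m * (n * n + m) + (m * r + n * c)
  ≤⟨ +-cancelʳ-≤ (n * n * c) _ _ (begin
      P * (n * n) + m * (n * n + m) + (m * r + n * c) + n * n * c
    ≡⟨ solve (m ∷ c ∷ P ∷ r ∷ []) ⟩
      (n * (n * (n * 1)) + m * (m * 1) + m * (P * n + r)) + suc P * n * c
    ≤⟨ +-monoʳ-≤ (n * (n * (n * 1)) + m * (m * 1) + m * (P * n + r)) (*-monoˡ-≤ c (*-monoˡ-≤ n P<n)) ⟩
      (n * (n * (n * 1)) + m * (m * 1) + m * (P * n + r)) + n * n * c ∎) ⟩
    n * (n * (n * 1)) + m * (m * 1) + m * (P * n + r) ∎)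
  where open ≤-Reasoning

binBound₁ : ∀ n m → m ≤ n → BinBound n m (n ^ 3 + m ^ 2)
binBound₁ n m m≤n P K r _ r≤n size≤ with n ≤? P
... | yes n≤P with m≤n⇒∃[o]m+o≡n n≤P
...   | p , refl = manyBins₁ n m p K r (+-cancelˡ-≤ (n * n) _ _ (≤-trans (≤-reflexive size≡) size≤))
  where
  size≡ : n * n + (p * n + K + r) ≡ (n + p) * n + K + r
  size≡ = solve (n ∷ p ∷ K ∷ r ∷ [])
binBound₁ n m m≤n P K r _ r≤n size≤ | no n≰P with m≤n⇒∃[o]m+o≡n m≤n
...   | c , refl = fewBins₁ m c P K r (≰⇒> n≰P) r≤n size≤

manyBins₂ : ∀ n a p K r → p * n + K + r ≤ a →
  (suc n + p) * (n * n) + K * (n + a) + r * r ≤ n ^ 3 + n ^ 2 + (n + a) * a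
manyBins₂ n a p K r size≤ = begin
    (suc n + p) * (n * n) + K * (n + a) + r * r
  ≡⟨ solve (n ∷ a ∷ p ∷ K ∷ r ∷ []) ⟩
    n * (n * (n * 1)) + n * (n * 1) + (p * n * n + K * n + K * a + r * r)
  ≤⟨ +-monoʳ-≤ (n * (n * (n * 1)) + n * (n * 1)) (+-monoʳ-≤ (p * n * n + K * n + K * a) r*r≤) ⟩
    n * (n * (n * 1)) + n * (n * 1) + (p * n * n + K * n + K * a + (r * n + r * a))
  ≡⟨ solve (n ∷ a ∷ p ∷ K ∷ r ∷ []) ⟩
    n * (n * (n * 1)) + n * (n * 1) + (n * (p * n + K + r) + a * (K + r))
  ≤⟨ +-monoʳ-≤ (n * (n * (n * 1)) + n * (n * 1))
      (+-mono-≤ (*-monoʳ-≤ n size≤) (*-monoʳ-≤ a K+r≤a)) ⟩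
    n * (n * (n * 1)) + n * (n * 1) + (n * a + a * a)
  ≡⟨ solve (n ∷ a ∷ []) ⟩
    n * (n * (n * 1)) + n * (n * 1) + (n + a) * a ∎
  where
  open ≤-Reasoning
  K+r≤a : K + r ≤ a
  K+r≤a = ≤-trans (+-monoˡ-≤ r (m≤n+m K (p * n))) size≤
  r*r≤ : r * r ≤ r * n + r * a
  r*r≤ = ≤-trans (*-monoʳ-≤ r (≤-trans (m≤n+m r K) K+r≤a)) (m≤n+m (r * a) (r * n))

equalBins₂ : ∀ n a K r → K ≤ n → r ≤ n → K + r ≤ n + a →
  n * (n * n) + K * (n + a) + r * r ≤ n ^ 3 + n ^ 2 + (n + a) * a
equalBins₂ n a K r K≤n r≤n K+r≤ with r ≤? a
... | yes r≤a = begin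
    n * (n * n) + K * (n + a) + r * r
  ≤⟨ +-mono-≤ (+-monoʳ-≤ (n * (n * n)) (*-monoˡ-≤ (n + a) K≤n)) (*-mono-≤ r≤a r≤a) ⟩
    n * (n * n) + n * (n + a) + a * a
  ≡⟨ solve (n ∷ a ∷ []) ⟩
    n * (n * (n * 1)) + n * (n * 1) + (n + a) * a ∎
  where open ≤-Reasoning
... | no r≰a with m≤n⇒∃[o]m+o≡n (<⇒≤ (≰⇒> r≰a))
...   | s , refl with m≤n⇒∃[o]m+o≡n r≤n
...     | t , refl = let n = a + s + t ; r = a + s in +-cancelʳ-≤ (r * (n + a)) _ _ (begin
    n * (n * n) + K * (n + a) + r * r + r * (n + a)
  ≡⟨ solve (a ∷ s ∷ t ∷ K ∷ []) ⟩
    n * (n * n) + ((K + r) * (n + a) + r * r)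
  ≤⟨ +-monoʳ-≤ (n * (n * n)) (+-monoˡ-≤ (r * r) (*-monoˡ-≤ (n + a) K+r≤)) ⟩
    n * (n * n) + ((n + a) * (n + a) + r * r)
  ≤⟨ m≤m+n _ (s * t) ⟩
    n * (n * n) + ((n + a) * (n + a) + r * r) + s * t
  ≡⟨ solve (a ∷ s ∷ t ∷ []) ⟩
    n * (n * (n * 1)) + n * (n * 1) + (n + a) * a + r * (n + a) ∎)
  where open ≤-Reasoning

fewBins₂ : ∀ n a P K r → P < n → K ≤ P → r ≤ n →
  P * (n * n) + K * (n + a) + r * r ≤ n ^ 3 + n ^ 2 + (n + a) * a
fewBins₂ n a P K r P<n K≤P r≤n with m≤n⇒∃[o]m+o≡n P<n
... | e , refl = let n = suc P + e in begin
    P * (n * n) + K * (n + a) + r * r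
  ≤⟨ +-mono-≤ (+-monoʳ-≤ (P * (n * n)) (*-monoˡ-≤ (n + a) K≤P)) (*-mono-≤ r≤n r≤n) ⟩
    P * (n * n) + P * (n + a) + n * n
  ≤⟨ m≤m+n _ (n * n * e + n * (1 + e) + a * (1 + e) + a * a) ⟩
    P * (n * n) + P * (n + a) + n * n + (n * n * e + n * (1 + e) + a * (1 + e) + a * a)
  ≡⟨ solve (a ∷ P ∷ e ∷ []) ⟩
    n * (n * (n * 1)) + n * (n * 1) + (n + a) * a ∎
  where open ≤-Reasoning

binBound₂ : ∀ n a → BinBound n (n + a) (n ^ 3 + n ^ 2 + (n + a) * a)
binBound₂ n a P K r K≤P r≤n size≤ with <-cmp P n
... | tri< P<n _ _ = fewBins₂ n a P K r P<n K≤P r≤n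
... | tri≈ _ refl _ = equalBins₂ n a K r K≤P r≤n
  (+-cancelˡ-≤ (n * n) _ _ (≤-trans (≤-reflexive (sym (+-assoc (n * n) K r))) size≤))
... | tri> _ _ n<P with m≤n⇒∃[o]m+o≡n n<P
...   | p , refl = manyBins₂ n a p K r (+-cancelˡ-≤ (n * n + n) _ _ (begin
    n * n + n + (p * n + K + r)
  ≡⟨ solve (n ∷ p ∷ K ∷ r ∷ []) ⟩
    (suc n + p) * n + K + r
  ≤⟨ size≤ ⟩
    n * n + (n + a)
  ≡⟨ sym (+-assoc (n * n) n a) ⟩
    n * n + n + a ∎))
  where open ≤-Reasoning

upperBound₁ : ∀ n m → m ≤ n → BipUpperBound (n * n + m) (n ^ 3 + m ^ 2)
upperBound₁ n m m≤n =
  bipUpperBound-fromPacking n _ _ (packingBound-fromBins n m _ (binBound₁ n m m≤n))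

upperBound₂ : ∀ n c → BipUpperBound (n * n + (n + c)) (n ^ 3 + n ^ 2 + (n + c) * c)
upperBound₂ n c = bipUpperBound-fromPacking n _ _ (packingBound-fromBins n (n + c) _ (binBound₂ n c))

sumBelow : ℕ → (ℕ → ℕ) → ℕ
sumBelow zero    f = 0
sumBelow (suc v) f = f 0 + sumBelow v (f ∘ suc)

sumFin-toℕ : ∀ {v} (f : ℕ → ℕ) → sumFin {v} (f ∘ toℕ) ≡ sumBelow v f
sumFin-toℕ {zero}  f = refl
sumFin-toℕ {suc v} f = cong (f 0 +_) (sumFin-toℕ {v} (f ∘ suc))

sumBelow-cong : ∀ v {f g : ℕ → ℕ} → (∀ k → k < v → f k ≡ g k) → sumBelow v f ≡ sumBelow v g
sumBelow-cong zero    _   = refl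
sumBelow-cong (suc v) f≡g = cong₂ _+_ (f≡g 0 z<s) (sumBelow-cong v (λ k k<v → f≡g (suc k) (s<s k<v)))

sumBelow-zero : ∀ v {f : ℕ → ℕ} → (∀ k → k < v → f k ≡ 0) → sumBelow v f ≡ 0
sumBelow-zero zero    _  = refl
sumBelow-zero (suc v) f≡0 = cong₂ _+_ (f≡0 0 z<s) (sumBelow-zero v (λ k k<v → f≡0 (suc k) (s<s k<v)))

sumBelow-const : ∀ v c → sumBelow v (λ _ → c) ≡ v * c
sumBelow-const zero    c = refl
sumBelow-const (suc v) c = cong (c +_) (sumBelow-const v c)

sumBelow-split : ∀ a b (f : ℕ → ℕ) → sumBelow (a + b) f ≡ sumBelow a f + sumBelow b (λ k → f (a + k))
sumBelow-split zero    b f = refl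
sumBelow-split (suc a) b f = trans (cong (f 0 +_) (sumBelow-split a b (f ∘ suc))) (sym (+-assoc (f 0) _ _))

sumBelow-suc : ∀ v (f : ℕ → ℕ) → sumBelow (suc v) f ≡ sumBelow v f + f v
sumBelow-suc v f = begin
    sumBelow (suc v) f
  ≡⟨ cong (λ w → sumBelow w f) (+-comm 1 v) ⟩
    sumBelow (v + 1) f
  ≡⟨ sumBelow-split v 1 f ⟩
    sumBelow v f + (f (v + 0) + 0)
  ≡⟨ cong (sumBelow v f +_) (trans (+-identityʳ _) (cong f (+-identityʳ v))) ⟩
    sumBelow v f + f v ∎
  where open ≡-Reasoning

sumBelow-+ : ∀ v (f g : ℕ → ℕ) → sumBelow v (λ k → f k + g k) ≡ sumBelow v f + sumBelow v g
sumBelow-+ zero    f g = refl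
sumBelow-+ (suc v) f g = trans (cong ((f 0 + g 0) +_) (sumBelow-+ v (f ∘ suc) (g ∘ suc)))
                               (+-interchange (f 0) (g 0) (sumBelow v (f ∘ suc)) (sumBelow v (g ∘ suc)))

sumBelow-*ˡ : ∀ v c (f : ℕ → ℕ) → sumBelow v (λ k → c * f k) ≡ c * sumBelow v f
sumBelow-*ˡ zero    c f = sym (*-zeroʳ c)
sumBelow-*ˡ (suc v) c f = trans (cong (c * f 0 +_) (sumBelow-*ˡ v c (f ∘ suc)))
                                (sym (*-distribˡ-+ c (f 0) _))

sumBelow-prefix : ∀ v k X Y → k ≤ v → sumBelow v (λ a → if a <ᵇ k then X else Y) ≡ k * X + (v ∸ k) * Y
sumBelow-prefix v k X Y k≤v = begin
    sumBelow v (λ a → if a <ᵇ k then X else Y)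
  ≡⟨ cong (λ w → sumBelow w (λ a → if a <ᵇ k then X else Y)) (sym (m+[n∸m]≡n k≤v)) ⟩
    sumBelow (k + (v ∸ k)) (λ a → if a <ᵇ k then X else Y)
  ≡⟨ sumBelow-split k (v ∸ k) _ ⟩
    sumBelow k (λ a → if a <ᵇ k then X else Y) + sumBelow (v ∸ k) (λ a → if k + a <ᵇ k then X else Y)
  ≡⟨ cong₂ _+_ (sumBelow-cong k (λ a a<k → cong (if_then X else Y) (<ᵇ-true a<k)))
               (sumBelow-cong (v ∸ k) (λ a _ → cong (if_then X else Y) (<ᵇ-false (m≤m+n k a)))) ⟩
    sumBelow k (λ _ → X) + sumBelow (v ∸ k) (λ _ → Y)
  ≡⟨ cong₂ _+_ (sumBelow-const k X) (sumBelow-const (v ∸ k) Y) ⟩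
    k * X + (v ∸ k) * Y ∎
  where open ≡-Reasoning

sumBelow-count-< : ∀ v k → k ≤ v → sumBelow v (λ a → ind (a <ᵇ k)) ≡ k
sumBelow-count-< v k k≤v = trans (sumBelow-prefix v k 1 0 k≤v)
  (trans (cong₂ _+_ (*-identityʳ k) (*-zeroʳ (v ∸ k))) (+-identityʳ k))

sumBelow-count-≢ : ∀ n a → a ≤ n → sumBelow (suc n) (λ j → ind (not (j ≡ᵇ a))) ≡ n
sumBelow-count-≢ n       zero    _         = trans (sumBelow-const n 1) (*-identityʳ n)
sumBelow-count-≢ (suc n) (suc a) (s≤s a≤n) = cong suc (sumBelow-count-≢ n a a≤n)

relAdj : (ℕ → ℕ → Bool) → ℕ → ℕ → Bool
relAdj r a b = (r a b ∨ r b a) ∧ not (a ≡ᵇ b)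

relAdj-sym : ∀ r a b → relAdj r a b ≡ relAdj r b a
relAdj-sym r a b = cong₂ _∧_ (∨-comm (r a b) (r b a)) (cong not (≡ᵇ-sym a b))

relDeg : ℕ → (ℕ → ℕ → Bool) → ℕ → ℕ
relDeg V r a = sumBelow V (ind ∘ relAdj r a)

deg-fromRel : ∀ V r (i : Fin V) → deg (fromRel V r) i ≡ relDeg V r (toℕ i)
deg-fromRel V r i = sumFin-toℕ {V} (ind ∘ relAdj r (toℕ i))

edgeSum-cong : ∀ {v} (G : Graph v) {f g : Fin v → Fin v → ℕ} → (∀ i j → f i j ≡ g i j) →
  edgeSum G f ≡ edgeSum G g
edgeSum-cong G f≡g = sumFin-cong (λ i → sumFin-cong (λ j →
  cong (if adj G i j ∧ (toℕ i <ᵇ toℕ j) then_else 0) (f≡g i j)))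

module BlockBipartite (V p q : ℕ) (p+q≡V : p + q ≡ V) (r : ℕ → ℕ → Bool)
  (inside₁ : ∀ {a b} → a < p → b < p → relAdj r a b ≡ false)
  (inside₂ : ∀ {k l} → k < q → l < q → relAdj r (p + k) (p + l) ≡ false) where

  cross : ℕ → ℕ → Bool
  cross a k = relAdj r a (p + k)

  private
    sumBelow-blocks : ∀ f → sumBelow V f ≡ sumBelow p f + sumBelow q (λ k → f (p + k))
    sumBelow-blocks f = trans (cong (λ w → sumBelow w f) (sym p+q≡V)) (sumBelow-split p q f)

  relDeg-left : ∀ {a} → a < p → relDeg V r a ≡ sumBelow q (ind ∘ cross a)
  relDeg-left {a} a<p = begin
      relDeg V r a
    ≡⟨ sumBelow-blocks (ind ∘ relAdj r a) ⟩
      sumBelow p (ind ∘ relAdj r a) + sumBelow q (ind ∘ cross a)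
    ≡⟨ cong (_+ sumBelow q (ind ∘ cross a)) (sumBelow-zero p (λ b b<p → cong ind (inside₁ a<p b<p))) ⟩
      sumBelow q (ind ∘ cross a) ∎
    where open ≡-Reasoning

  relDeg-right : ∀ {k} → k < q → relDeg V r (p + k) ≡ sumBelow p (λ a → ind (cross a k))
  relDeg-right {k} k<q = begin
      relDeg V r (p + k)
    ≡⟨ sumBelow-blocks (ind ∘ relAdj r (p + k)) ⟩
      sumBelow p (ind ∘ relAdj r (p + k)) + sumBelow q (λ l → ind (relAdj r (p + k) (p + l)))
    ≡⟨ cong₂ _+_ (sumBelow-cong p (λ a _ → cong ind (relAdj-sym r (p + k) a)))
                 (sumBelow-zero q (λ l l<q → cong ind (inside₂ k<q l<q))) ⟩
      sumBelow p (λ a → ind (cross a k)) + 0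
    ≡⟨ +-identityʳ _ ⟩
      sumBelow p (λ a → ind (cross a k)) ∎
    where open ≡-Reasoning

  edgeSum-blocks : ∀ (f : ℕ → ℕ → ℕ) →
    edgeSum (fromRel V r) (λ i j → f (toℕ i) (toℕ j))
    ≡ sumBelow p (λ a → sumBelow q (λ k → if cross a k then f a (p + k) else 0))
  edgeSum-blocks f = begin
      edgeSum (fromRel V r) (λ i j → f (toℕ i) (toℕ j))
    ≡⟨ sumFin-cong {V} (λ i → sumFin-toℕ {V} (entry (toℕ i))) ⟩
      sumFin {V} (row ∘ toℕ)
    ≡⟨ sumFin-toℕ {V} row ⟩
      sumBelow V row
    ≡⟨ sumBelow-blocks row ⟩
      sumBelow p row + sumBelow q (λ k → row (p + k))
    ≡⟨ cong₂ _+_ (sumBelow-cong p (λ a → row-left)) (sumBelow-zero q (λ k → row-right)) ⟩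
      sumBelow p (λ a → sumBelow q (λ k → if cross a k then f a (p + k) else 0)) + 0
    ≡⟨ +-identityʳ _ ⟩
      sumBelow p (λ a → sumBelow q (λ k → if cross a k then f a (p + k) else 0)) ∎
    where
    open ≡-Reasoning
    entry : ℕ → ℕ → ℕ
    entry a b = if relAdj r a b ∧ (a <ᵇ b) then f a b else 0
    row : ℕ → ℕ
    row a = sumBelow V (entry a)

    row-left : ∀ {a} → a < p → row a ≡ sumBelow q (λ k → if cross a k then f a (p + k) else 0)
    row-left {a} a<p = begin
        row a
      ≡⟨ sumBelow-blocks (entry a) ⟩
        sumBelow p (entry a) + sumBelow q (λ k → entry a (p + k))
      ≡⟨ cong₂ _+_
           (sumBelow-zero p (λ b b<p → cong (if_then f a b else 0)
             (cong (_∧ (a <ᵇ b)) (inside₁ a<p b<p))))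
           (sumBelow-cong q (λ k _ → cong (if_then f a (p + k) else 0)
             (trans (cong (cross a k ∧_) (<ᵇ-true (≤-trans a<p (m≤m+n p k))))
                    (∧-identityʳ (cross a k))))) ⟩
        sumBelow q (λ k → if cross a k then f a (p + k) else 0) ∎

    row-right : ∀ {k} → k < q → row (p + k) ≡ 0
    row-right {k} k<q = begin
        row (p + k)
      ≡⟨ sumBelow-blocks (entry (p + k)) ⟩
        sumBelow p (entry (p + k)) + sumBelow q (λ l → entry (p + k) (p + l))
      ≡⟨ cong₂ _+_
           (sumBelow-zero p (λ b b<p → cong (if_then f (p + k) b else 0)
             (trans (cong (relAdj r (p + k) b ∧_) (<ᵇ-false (≤-trans (<⇒≤ b<p) (m≤m+n p k))))
                    (∧-zeroʳ (relAdj r (p + k) b)))))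
           (sumBelow-zero q (λ l l<q → cong (if_then f (p + k) (p + l) else 0)
             (cong (_∧ (p + k <ᵇ p + l)) (inside₂ k<q l<q)))) ⟩
        0 ∎

  bipartite : Bipartite (fromRel V r)
  bipartite = (λ i → toℕ i <ᵇ p) , proper
    where
    side : ∀ (i : Fin V) → toℕ i < p ⊎ Σ ℕ (λ k → k < q × toℕ i ≡ p + k)
    side i with toℕ i <? p
    ... | yes i<p = inj₁ i<p
    ... | no  i≮p with m≤n⇒∃[o]m+o≡n (≮⇒≥ i≮p)
    ...   | k , p+k≡i = inj₂ (k , +-cancelˡ-< p k q (subst₂ _<_ (sym p+k≡i) (sym p+q≡V) (toℕ<n i)) , sym p+k≡i)

    colour-right : ∀ {i : Fin V} {k} → toℕ i ≡ p + k → (toℕ i <ᵇ p) ≡ false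
    colour-right {k = k} i≡p+k = subst (λ x → (x <ᵇ p) ≡ false) (sym i≡p+k) (<ᵇ-false (m≤m+n p k))

    proper : ProperColouring (fromRel V r) (λ i → toℕ i <ᵇ p)
    proper i j a same with side i | side j
    ... | inj₁ i<p | inj₁ j<p with () ← trans (sym a) (inside₁ i<p j<p)
    ... | inj₁ i<p | inj₂ (_ , _ , j≡p+l) with () ← trans (sym (<ᵇ-true i<p)) (trans same (colour-right j≡p+l))
    ... | inj₂ (_ , _ , i≡p+k) | inj₁ j<p with () ← trans (sym (colour-right i≡p+k)) (trans same (<ᵇ-true j<p))
    ... | inj₂ (k , k<q , i≡p+k) | inj₂ (l , l<q , j≡p+l)
      with () ← trans (sym (subst₂ (λ x y → relAdj r x y ≡ true) i≡p+k j≡p+l a)) (inside₂ k<q l<q)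

  numEdges-blocks : numEdges (fromRel V r) ≡ sumBelow p (λ a → sumBelow q (ind ∘ cross a))
  numEdges-blocks = edgeSum-blocks (λ _ _ → 1)

  specialty-blocks : specialty (fromRel V r)
    ≡ sumBelow p (λ a → sumBelow q (λ k → if cross a k then relDeg V r a ⊓ relDeg V r (p + k) else 0))
  specialty-blocks = trans
    (edgeSum-cong (fromRel V r) (λ i j → cong₂ _⊓_ (deg-fromRel V r i) (deg-fromRel V r j)))
    (edgeSum-blocks (λ a b → relDeg V r a ⊓ relDeg V r b))

module Extremal₁ (n m : ℕ) (m≤n : m ≤ n) where

  rel₁ : ℕ → ℕ → Bool
  rel₁ a b = ((a <ᵇ n) ∧ ((n ≤ᵇ b) ∧ (b <ᵇ n + n))) ∨ ((a ≡ᵇ n + n) ∧ (b <ᵇ m))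

  private
    <n⇒≢n+n : ∀ {a} → a < n → a ≢ n + n
    <n⇒≢n+n a<n = <⇒≢ (≤-trans a<n (m≤m+n n n))

    rel₁-left : ∀ {a b} → a < n → b < n → rel₁ a b ≡ false
    rel₁-left {a} {b} a<n b<n rewrite <ᵇ-true a<n | ≤ᵇ-false b<n | ≡ᵇ-false (<n⇒≢n+n a<n) = refl

    rel₁-right : ∀ k {b} → m ≤ b → rel₁ (n + k) b ≡ false
    rel₁-right k m≤b rewrite <ᵇ-false (m≤m+n n k) | <ᵇ-false m≤b = ∧-zeroʳ _

  inside₁ : ∀ {a b} → a < n → b < n → relAdj rel₁ a b ≡ false
  inside₁ a<n b<n rewrite rel₁-left a<n b<n | rel₁-left b<n a<n = refl

  inside₂ : ∀ {k l} → k < suc n → l < suc n → relAdj rel₁ (n + k) (n + l) ≡ false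
  inside₂ {k} {l} _ _
    rewrite rel₁-right k (≤-trans m≤n (m≤m+n n l)) | rel₁-right l (≤-trans m≤n (m≤m+n n k)) = refl

  open BlockBipartite (suc (n + n)) n (suc n) (+-suc n n) rel₁ inside₁ inside₂

  cross-complete : ∀ {a k} → a < n → k < n → cross a k ≡ true
  cross-complete {a} {k} a<n k<n
    rewrite <ᵇ-true a<n | ≤ᵇ-true (m≤m+n n k) | <ᵇ-true (+-monoʳ-< n k<n)
          | ≡ᵇ-false (<⇒≢ (≤-trans a<n (m≤m+n n k))) = refl

  cross-new : ∀ {a} → a < n → cross a n ≡ (a <ᵇ m)
  cross-new {a} a<n
    rewrite <ᵇ-true a<n | ≤ᵇ-true (m≤m+n n n) | <ᵇ-false (≤-refl {n + n})
          | ≡ᵇ-false (<n⇒≢n+n a<n) | ≡ᵇ-refl (n + n) | <ᵇ-false (m≤m+n n n) = ∧-identityʳ (a <ᵇ m)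

  deg₁ : ℕ → ℕ
  deg₁ = relDeg (suc (n + n)) rel₁

  crossCount-left : ∀ {a} → a < n → sumBelow (suc n) (ind ∘ cross a) ≡ n + ind (a <ᵇ m)
  crossCount-left {a} a<n = begin
      sumBelow (suc n) (ind ∘ cross a)
    ≡⟨ sumBelow-suc n (ind ∘ cross a) ⟩
      sumBelow n (ind ∘ cross a) + ind (cross a n)
    ≡⟨ cong₂ _+_ (sumBelow-cong n (λ k k<n → cong ind (cross-complete a<n k<n))) (cong ind (cross-new a<n)) ⟩
      sumBelow n (λ _ → 1) + ind (a <ᵇ m)
    ≡⟨ cong (_+ ind (a <ᵇ m)) (trans (sumBelow-const n 1) (*-identityʳ n)) ⟩
      n + ind (a <ᵇ m) ∎
    where open ≡-Reasoning

  deg₁-left : ∀ {a} → a < n → deg₁ a ≡ n + ind (a <ᵇ m)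
  deg₁-left a<n = trans (relDeg-left a<n) (crossCount-left a<n)

  deg₁-right : ∀ {k} → k < n → deg₁ (n + k) ≡ n
  deg₁-right {k} k<n = begin
      deg₁ (n + k)
    ≡⟨ relDeg-right (m<n⇒m<1+n k<n) ⟩
      sumBelow n (λ a → ind (cross a k))
    ≡⟨ sumBelow-cong n (λ a a<n → cong ind (cross-complete a<n k<n)) ⟩
      sumBelow n (λ _ → 1)
    ≡⟨ trans (sumBelow-const n 1) (*-identityʳ n) ⟩
      n ∎
    where open ≡-Reasoning

  deg₁-new : deg₁ (n + n) ≡ m
  deg₁-new = begin
      deg₁ (n + n)
    ≡⟨ relDeg-right (n<1+n n) ⟩
      sumBelow n (λ a → ind (cross a n))
    ≡⟨ sumBelow-cong n (λ a a<n → cong ind (cross-new a<n)) ⟩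
      sumBelow n (λ a → ind (a <ᵇ m))
    ≡⟨ sumBelow-count-< n m m≤n ⟩
      m ∎
    where open ≡-Reasoning

  numEdges₁ : numEdges (extremal₁ n m) ≡ n * n + m
  numEdges₁ = begin
      numEdges (extremal₁ n m)
    ≡⟨ numEdges-blocks ⟩
      sumBelow n (λ a → sumBelow (suc n) (ind ∘ cross a))
    ≡⟨ sumBelow-cong n (λ a → crossCount-left) ⟩
      sumBelow n (λ a → n + ind (a <ᵇ m))
    ≡⟨ sumBelow-+ n (λ _ → n) (λ a → ind (a <ᵇ m)) ⟩
      sumBelow n (λ _ → n) + sumBelow n (λ a → ind (a <ᵇ m))
    ≡⟨ cong₂ _+_ (sumBelow-const n n) (sumBelow-count-< n m m≤n) ⟩
      n * n + m ∎
    where open ≡-Reasoning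

  specialtyRow₁ : ∀ {a} → a < n →
    sumBelow (suc n) (λ k → if cross a k then deg₁ a ⊓ deg₁ (n + k) else 0) ≡ n * n + m * ind (a <ᵇ m)
  specialtyRow₁ {a} a<n = begin
      sumBelow (suc n) (λ k → if cross a k then deg₁ a ⊓ deg₁ (n + k) else 0)
    ≡⟨ sumBelow-suc n _ ⟩
      sumBelow n (λ k → if cross a k then deg₁ a ⊓ deg₁ (n + k) else 0)
        + (if cross a n then deg₁ a ⊓ deg₁ (n + n) else 0)
    ≡⟨ cong₂ _+_ (sumBelow-cong n (λ k k<n → completeEntry (cross-complete a<n k<n) k<n))
                 (cong₂ (λ x d → if x then d else 0) (cross-new a<n) (cong₂ _⊓_ (deg₁-left a<n) deg₁-new)) ⟩
      sumBelow n (λ _ → n) + (if a <ᵇ m then (n + ind (a <ᵇ m)) ⊓ m else 0)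
    ≡⟨ cong₂ _+_ (sumBelow-const n n) (newEntry (a <ᵇ m)) ⟩
      n * n + m * ind (a <ᵇ m) ∎
    where
    open ≡-Reasoning
    completeEntry : ∀ {k} → cross a k ≡ true → k < n → (if cross a k then deg₁ a ⊓ deg₁ (n + k) else 0) ≡ n
    completeEntry c≡true k<n rewrite c≡true | deg₁-left a<n | deg₁-right k<n = m≥n⇒m⊓n≡n (m≤m+n n _)
    newEntry : ∀ x → (if x then (n + ind x) ⊓ m else 0) ≡ m * ind x
    newEntry true  = trans (m≥n⇒m⊓n≡n (≤-trans m≤n (m≤m+n n 1))) (sym (*-identityʳ m))
    newEntry false = sym (*-zeroʳ m)

  specialty₁ : specialty (extremal₁ n m) ≡ n ^ 3 + m ^ 2
  specialty₁ = begin
      specialty (extremal₁ n m)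
    ≡⟨ specialty-blocks ⟩
      sumBelow n (λ a → sumBelow (suc n) (λ k → if cross a k then deg₁ a ⊓ deg₁ (n + k) else 0))
    ≡⟨ sumBelow-cong n (λ a → specialtyRow₁) ⟩
      sumBelow n (λ a → n * n + m * ind (a <ᵇ m))
    ≡⟨ sumBelow-+ n (λ _ → n * n) (λ a → m * ind (a <ᵇ m)) ⟩
      sumBelow n (λ _ → n * n) + sumBelow n (λ a → m * ind (a <ᵇ m))
    ≡⟨ cong₂ _+_ (sumBelow-const n (n * n))
                 (trans (sumBelow-*ˡ n m _) (cong (m *_) (sumBelow-count-< n m m≤n))) ⟩
      n * (n * n) + m * m
    ≡⟨ solve (n ∷ m ∷ []) ⟩
      n * (n * (n * 1)) + m * (m * 1) ∎
    where open ≡-Reasoning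

  attains₁ : Attains (extremal₁ n m) (n * n + m) (n ^ 3 + m ^ 2)
  attains₁ = bipartite , numEdges₁ , specialty₁

≡ᵇ-+ˡ : ∀ w a b → (w + a ≡ᵇ w + b) ≡ (a ≡ᵇ b)
≡ᵇ-+ˡ zero    a b = refl
≡ᵇ-+ˡ (suc w) a b = ≡ᵇ-+ˡ w a b

≡ᵇ-∧-transport : ∀ a b (P : ℕ → Bool) → (a ≡ᵇ b) ∧ P b ≡ (b ≡ᵇ a) ∧ P a
≡ᵇ-∧-transport a b P with a ≡ᵇ b in a≡ᵇb
... | false rewrite ≡ᵇ-sym b a | a≡ᵇb = refl
... | true  rewrite ≡ᵇ⇒≡ a b (subst T (sym a≡ᵇb) _) | ≡ᵇ-refl b = refl

matching-numEdges : ∀ n k c → k + c ≡ suc n → k * n + c * suc n ≡ n * n + (n + c)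
matching-numEdges n k c k+c≡1+n = begin
    k * n + c * suc n
  ≡⟨ solve (n ∷ k ∷ c ∷ []) ⟩
    (k + c) * n + c
  ≡⟨ cong (λ x → x * n + c) k+c≡1+n ⟩
    suc n * n + c
  ≡⟨ solve (n ∷ c ∷ []) ⟩
    n * n + (n + c) ∎
  where open ≡-Reasoning

matching-specialty : ∀ n k c → k + c ≡ suc n →
  k * (n * n) + c * (k * n + c * suc n) ≡ n ^ 3 + n ^ 2 + (n + c) * c
matching-specialty n k c k+c≡1+n = +-cancelʳ-≡ (c * (n * n)) _ _ (begin
    k * (n * n) + c * (k * n + c * suc n) + c * (n * n)
  ≡⟨ solve (n ∷ k ∷ c ∷ []) ⟩
    (k + c) * (n * n) + c * ((k + c) * n) + c * c
  ≡⟨ cong (λ x → x * (n * n) + c * (x * n) + c * c) k+c≡1+n ⟩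
    suc n * (n * n) + c * (suc n * n) + c * c
  ≡⟨ solve (n ∷ c ∷ []) ⟩
    n * (n * (n * 1)) + n * (n * 1) + (n + c) * c + c * (n * n) ∎)
  where open ≡-Reasoning

module Extremal₂ (n c : ℕ) (c≤1+n : c ≤ suc n) where

  k₀ : ℕ
  k₀ = 2 * n + 1 ∸ (n + c)

  k₀+c≡1+n : k₀ + c ≡ suc n
  k₀+c≡1+n = begin
      2 * n + 1 ∸ (n + c) + c
    ≡⟨ cong (λ x → x ∸ (n + c) + c) (solve (n ∷ [])) ⟩
      n + suc n ∸ (n + c) + c
    ≡⟨ cong (_+ c) ([m+n]∸[m+o]≡n∸o n (suc n) c) ⟩
      suc n ∸ c + c
    ≡⟨ m∸n+n≡m c≤1+n ⟩
      suc n ∎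
    where open ≡-Reasoning

  rel₂ : ℕ → ℕ → Bool
  rel₂ a b = (a <ᵇ suc n) ∧ ((suc n ≤ᵇ b) ∧ not ((b ≡ᵇ a + suc n) ∧ (a <ᵇ k₀)))

  private
    rel₂-left : ∀ {a b} → a < suc n → b < suc n → rel₂ a b ≡ false
    rel₂-left a<w b<w rewrite <ᵇ-true a<w | ≤ᵇ-false b<w = refl

  inside₁ : ∀ {a b} → a < suc n → b < suc n → relAdj rel₂ a b ≡ false
  inside₁ a<w b<w rewrite rel₂-left a<w b<w | rel₂-left b<w a<w = refl

  inside₂ : ∀ {k l} → k < suc n → l < suc n → relAdj rel₂ (suc n + k) (suc n + l) ≡ false
  inside₂ {k} {l} _ _ rewrite <ᵇ-false (m≤m+n (suc n) k) | <ᵇ-false (m≤m+n (suc n) l) = refl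

  open BlockBipartite (suc n + suc n) (suc n) (suc n) refl rel₂ inside₁ inside₂

  cross≡ : ∀ {a} j → a < suc n → cross a j ≡ not ((j ≡ᵇ a) ∧ (a <ᵇ k₀))
  cross≡ {a} j a<w
    rewrite <ᵇ-true a<w | ≤ᵇ-true (m≤m+n (suc n) j) | <ᵇ-false (m≤m+n (suc n) j)
          | ≡ᵇ-false (<⇒≢ (≤-trans a<w (m≤m+n (suc n) j)))
          | +-comm a (suc n) | ≡ᵇ-+ˡ (suc n) j a
          | ∨-identityʳ (not ((j ≡ᵇ a) ∧ (a <ᵇ k₀))) = ∧-identityʳ _

  k₀≤1+n : k₀ ≤ suc n
  k₀≤1+n = ≤-trans (m≤m+n k₀ c) (≤-reflexive k₀+c≡1+n)

  1+n∸k₀≡c : suc n ∸ k₀ ≡ c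
  1+n∸k₀≡c = trans (cong (_∸ k₀) (sym k₀+c≡1+n)) (m+n∸m≡n k₀ c)

  degOf : Bool → ℕ
  degOf x = if x then n else suc n

  deg₂ : ℕ → ℕ
  deg₂ = relDeg (suc n + suc n) rel₂

  count-unmatched : ∀ {a} → a < suc n → ∀ x →
    sumBelow (suc n) (λ j → ind (not ((j ≡ᵇ a) ∧ x))) ≡ degOf x
  count-unmatched {a} a<w true  = trans
    (sumBelow-cong (suc n) (λ j _ → cong (ind ∘ not) (∧-identityʳ (j ≡ᵇ a))))
    (sumBelow-count-≢ n a (≤-pred a<w))
  count-unmatched {a} a<w false = trans
    (sumBelow-cong (suc n) (λ j _ → cong (ind ∘ not) (∧-zeroʳ (j ≡ᵇ a))))
    (trans (sumBelow-const (suc n) 1) (*-identityʳ (suc n)))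

  crossCount-left : ∀ {a} → a < suc n → sumBelow (suc n) (ind ∘ cross a) ≡ degOf (a <ᵇ k₀)
  crossCount-left {a} a<w = trans (sumBelow-cong (suc n) (λ j _ → cong ind (cross≡ j a<w)))
                                  (count-unmatched a<w (a <ᵇ k₀))

  deg₂-left : ∀ {a} → a < suc n → deg₂ a ≡ degOf (a <ᵇ k₀)
  deg₂-left a<w = trans (relDeg-left a<w) (crossCount-left a<w)

  deg₂-right : ∀ {j} → j < suc n → deg₂ (suc n + j) ≡ degOf (j <ᵇ k₀)
  deg₂-right {j} j<w = begin
      deg₂ (suc n + j)
    ≡⟨ relDeg-right j<w ⟩
      sumBelow (suc n) (λ a → ind (cross a j))
    ≡⟨ sumBelow-cong (suc n) (λ a a<w → cong ind (trans (cross≡ j a<w)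
                                 (cong not (≡ᵇ-∧-transport j a (_<ᵇ k₀))))) ⟩
      sumBelow (suc n) (λ a → ind (not ((a ≡ᵇ j) ∧ (j <ᵇ k₀))))
    ≡⟨ count-unmatched j<w (j <ᵇ k₀) ⟩
      degOf (j <ᵇ k₀) ∎
    where open ≡-Reasoning

  numEdges₂ : numEdges (extremal₂ n (n + c)) ≡ n * n + (n + c)
  numEdges₂ = begin
      numEdges (extremal₂ n (n + c))
    ≡⟨ numEdges-blocks ⟩
      sumBelow (suc n) (λ a → sumBelow (suc n) (ind ∘ cross a))
    ≡⟨ sumBelow-cong (suc n) (λ a → crossCount-left) ⟩
      sumBelow (suc n) (λ a → if a <ᵇ k₀ then n else suc n)
    ≡⟨ sumBelow-prefix (suc n) k₀ n (suc n) k₀≤1+n ⟩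
      k₀ * n + (suc n ∸ k₀) * suc n
    ≡⟨ cong (λ x → k₀ * n + x * suc n) 1+n∸k₀≡c ⟩
      k₀ * n + c * suc n
    ≡⟨ matching-numEdges n k₀ c k₀+c≡1+n ⟩
      n * n + (n + c) ∎
    where open ≡-Reasoning

  specialtyRow₂ : ∀ {a} → a < suc n →
    sumBelow (suc n) (λ j → if cross a j then deg₂ a ⊓ deg₂ (suc n + j) else 0)
    ≡ (if a <ᵇ k₀ then n * n else k₀ * n + c * suc n)
  specialtyRow₂ {a} a<w = trans (sumBelow-cong (suc n) entry≡) (rowSum (a <ᵇ k₀))
    where
    open ≡-Reasoning
    entry≡ : ∀ j → j < suc n → (if cross a j then deg₂ a ⊓ deg₂ (suc n + j) else 0)
      ≡ (if not ((j ≡ᵇ a) ∧ (a <ᵇ k₀)) then degOf (a <ᵇ k₀) ⊓ degOf (j <ᵇ k₀) else 0)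
    entry≡ j j<w = cong₂ (λ x d → if x then d else 0)
      (cross≡ j a<w) (cong₂ _⊓_ (deg₂-left a<w) (deg₂-right j<w))

    matchedEntry : ∀ y z → (if not y then n ⊓ degOf z else 0) ≡ n * ind (not y)
    matchedEntry true  z     = sym (*-zeroʳ n)
    matchedEntry false true  = trans (⊓-idem n) (sym (*-identityʳ n))
    matchedEntry false false = trans (m≤n⇒m⊓n≡m (n≤1+n n)) (sym (*-identityʳ n))

    unmatchedEntry : ∀ z → suc n ⊓ degOf z ≡ degOf z
    unmatchedEntry true  = m≥n⇒m⊓n≡n (n≤1+n n)
    unmatchedEntry false = ⊓-idem (suc n)

    rowSum : ∀ x →
      sumBelow (suc n) (λ j → if not ((j ≡ᵇ a) ∧ x) then degOf x ⊓ degOf (j <ᵇ k₀) else 0)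
      ≡ (if x then n * n else k₀ * n + c * suc n)
    rowSum true = begin
        sumBelow (suc n) (λ j → if not ((j ≡ᵇ a) ∧ true) then n ⊓ degOf (j <ᵇ k₀) else 0)
      ≡⟨ sumBelow-cong (suc n) (λ j _ → trans
           (cong (λ y → if not y then n ⊓ degOf (j <ᵇ k₀) else 0) (∧-identityʳ (j ≡ᵇ a)))
           (matchedEntry (j ≡ᵇ a) (j <ᵇ k₀))) ⟩
        sumBelow (suc n) (λ j → n * ind (not (j ≡ᵇ a)))
      ≡⟨ sumBelow-*ˡ (suc n) n (λ j → ind (not (j ≡ᵇ a))) ⟩
        n * sumBelow (suc n) (λ j → ind (not (j ≡ᵇ a)))
      ≡⟨ cong (n *_) (sumBelow-count-≢ n a (≤-pred a<w)) ⟩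
        n * n ∎
    rowSum false = begin
        sumBelow (suc n) (λ j → if not ((j ≡ᵇ a) ∧ false) then suc n ⊓ degOf (j <ᵇ k₀) else 0)
      ≡⟨ sumBelow-cong (suc n) (λ j _ → trans
           (cong (λ y → if not y then suc n ⊓ degOf (j <ᵇ k₀) else 0) (∧-zeroʳ (j ≡ᵇ a)))
           (unmatchedEntry (j <ᵇ k₀))) ⟩
        sumBelow (suc n) (λ j → if j <ᵇ k₀ then n else suc n)
      ≡⟨ sumBelow-prefix (suc n) k₀ n (suc n) k₀≤1+n ⟩
        k₀ * n + (suc n ∸ k₀) * suc n
      ≡⟨ cong (λ x → k₀ * n + x * suc n) 1+n∸k₀≡c ⟩
        k₀ * n + c * suc n ∎

  specialty₂ : specialty (extremal₂ n (n + c)) ≡ n ^ 3 + n ^ 2 + (n + c) * c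
  specialty₂ = begin
      specialty (extremal₂ n (n + c))
    ≡⟨ specialty-blocks ⟩
      sumBelow (suc n) (λ a → sumBelow (suc n) (λ j → if cross a j then deg₂ a ⊓ deg₂ (suc n + j) else 0))
    ≡⟨ sumBelow-cong (suc n) (λ a → specialtyRow₂) ⟩
      sumBelow (suc n) (λ a → if a <ᵇ k₀ then n * n else k₀ * n + c * suc n)
    ≡⟨ sumBelow-prefix (suc n) k₀ (n * n) (k₀ * n + c * suc n) k₀≤1+n ⟩
      k₀ * (n * n) + (suc n ∸ k₀) * (k₀ * n + c * suc n)
    ≡⟨ cong (λ x → k₀ * (n * n) + x * (k₀ * n + c * suc n)) 1+n∸k₀≡c ⟩
      k₀ * (n * n) + c * (k₀ * n + c * suc n)
    ≡⟨ matching-specialty n k₀ c k₀+c≡1+n ⟩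
      n ^ 3 + n ^ 2 + (n + c) * c ∎
    where open ≡-Reasoning

  attains₂ : Attains (extremal₂ n (n + c)) (n * n + (n + c)) (n ^ 3 + n ^ 2 + (n + c) * c)
  attains₂ = bipartite , numEdges₂ , specialty₂

-- The hypothesis 1 ≤ m only makes the representation N = n² + m unique; the bounds also hold for m = 0.
theorem2 : ∀ (n m : ℕ) → 1 ≤ m → m ≤ 2 * n + 1 →
    (m ≤ n →
      BipUpperBound (n * n + m) (n ^ 3 + m ^ 2)
      × Attains (extremal₁ n m) (n * n + m) (n ^ 3 + m ^ 2))
    × (n + 1 ≤ m →
      BipUpperBound (n * n + m) (n ^ 3 + n ^ 2 + m * (m ∸ n))
      × Attains (extremal₂ n m) (n * n + m) (n ^ 3 + n ^ 2 + m * (m ∸ n)))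
theorem2 n m _ m≤2n+1 = (λ m≤n → upperBound₁ n m m≤n , Extremal₁.attains₁ n m m≤n) , case₂
  where
  case₂ : n + 1 ≤ m →
    BipUpperBound (n * n + m) (n ^ 3 + n ^ 2 + m * (m ∸ n))
    × Attains (extremal₂ n m) (n * n + m) (n ^ 3 + n ^ 2 + m * (m ∸ n))
  case₂ n<m with m≤n⇒∃[o]m+o≡n (≤-trans (m≤m+n n 1) n<m)
  ... | c , refl rewrite m+n∸m≡n n c = upperBound₂ n c , Extremal₂.attains₂ n c c≤1+n
    where
    c≤1+n : c ≤ suc n
    c≤1+n = +-cancelˡ-≤ n c (suc n) (≤-trans m≤2n+1 (≤-reflexive (solve (n ∷ []))))
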